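{- For every $n\geq 1$, $$\sum_{\sigma\in\tilde{\mathfrak S}_{n+1}} t^{d_3(\sigma)}q^{i_3(\sigma)}=\sum_{\omega\in\mathfrak S_n} t^{\hat d(\omega)}q^{\hat\imath(\omega)}.$$
   Context: $\mathfrak S_n$ is the set of permutations $\sigma=\sigma_1\cdots\sigma_n$ of $[n]$, and $\tilde{\mathfrak S}_{n}$ the set of $\sigma\in\mathfrak S_n$ with $\sigma_1=1$. For $\sigma\in\mathfrak S_m$: a $3$-descent is a position $i\in[m-2]$ such that $\sigma_i\sigma_{i+1}\sigma_{i+2}$ (standardized) is an odd permutation in $\mathfrak S_3$; $d_3(\sigma)$ is the number of $3$-descents. For $i\in[m-2]$, $c^3_i(\sigma)$ is the number of indices $j>i+1$ such that $\sigma_i\sigma_{i+1}\sigma_j$ (standardized) is an odd permutation of size $3$, and $i_3(\sigma)=\sum_{i=1}^{m-2}c^3_i(\sigma)$. For $\omega\in\mathfrak S_n$: an alternating descent is a position $i\in[n-1]$ with either $i$ odd and $\omega_i>\omega_{i+1}$, or $i$ even and $\omega_i<\omega_{i+1}$; $\hat d(\omega)$ is their number. For $i\in[n-1]$, $\hat c_i(\omega)$ is the number of $j>i$ with $\omega_i>\omega_j$ if $i$ is odd, and the number of $j>i$ with $\omega_i<\omega_j$ if $i$ is even; $\hat\imath(\omega)=\sum_{i=1}^{n-1}\hat c_i(\omega)$. -}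

module Defs where

open import Data.Bool using (Bool; true; false; not; _∧_; _∨_; if_then_else_)
open import Data.Nat using (ℕ; zero; suc; _+_; _<ᵇ_; _≡ᵇ_)
open import Data.Fin using (Fin; toℕ)
open import Data.Fin.Properties using (_≟_)
open import Data.List using (List; []; _∷_; map; filter; concatMap; length)
open import Data.Product using (_×_; _,_)
open import Data.Vec using (Vec; []; _∷_; toList)
open import Data.Fin using (Fin)
import Data.List.Relation.Unary.Unique.DecPropositional as UDP
import Data.List

words : (m k : ℕ) → List (Vec (Fin m) k)
words m zero = [] ∷ []
words m (suc k) = concatMap (λ x → map (x ∷_) (words m k)) (Data.List.allFin m)

-- Permutations of [m] in one-line notation, as lists of values,
-- using 0-based values 0..m-1 (only relative order matters below).
perms : ℕ → List (List ℕ)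
perms m = map (λ v → toList (Data.Vec.map toℕ v))
              (filter (λ v → UDP.unique? (_≟_ {m}) (toList v)) (words m m))
  where import Data.Vec

-- σ₁ = 1 (i.e. the smallest value, 0 in our 0-based encoding).
startsMin : List ℕ → Bool
startsMin (x ∷ _) = x ≡ᵇ 0
startsMin [] = false

permsFix1 : ℕ → List (List ℕ)
permsFix1 m = filter (λ σ → Data.Bool.T? (startsMin σ)) (perms m)
  where import Data.Bool

-- The standardization of a b c (distinct) is an odd permutation of S_3,
-- i.e. one of 132, 213, 321.
odd3 : ℕ → ℕ → ℕ → Bool
odd3 a b c = ((a <ᵇ c) ∧ (c <ᵇ b)) ∨ ((b <ᵇ a) ∧ (a <ᵇ c)) ∨ ((c <ᵇ b) ∧ (b <ᵇ a))

count : {A : Set} → (A → Bool) → List A → ℕ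
count p [] = 0
count p (x ∷ xs) = (if p x then 1 else 0) + count p xs

d3 : List ℕ → ℕ
d3 (x ∷ y ∷ z ∷ rest) = (if odd3 x y z then 1 else 0) + d3 (y ∷ z ∷ rest)
d3 _ = 0

i3 : List ℕ → ℕ
i3 (x ∷ y ∷ rest) = count (odd3 x y) rest + i3 (y ∷ rest)
i3 _ = 0

-- Alternating statistics; the Bool flag says whether the current
-- (1-based) position is odd.
dhatAux : Bool → List ℕ → ℕ
dhatAux odd (x ∷ y ∷ rest) =
  (if (if odd then y <ᵇ x else x <ᵇ y) then 1 else 0) + dhatAux (not odd) (y ∷ rest)
dhatAux _ _ = 0

ihatAux : Bool → List ℕ → ℕ
ihatAux odd (x ∷ rest) =
  count (λ y → if odd then y <ᵇ x else x <ᵇ y) rest + ihatAux (not odd) rest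
ihatAux _ [] = 0

dhat : List ℕ → ℕ
dhat = dhatAux true

ihat : List ℕ → ℕ
ihat = ihatAux true

module Submission where

-- Both sides of the identity are put in bijection with inversion codes,
-- i.e. lists c₁ … cₙ with cᵢ < n + 1 - i, in a way that sends (d₃, i₃),
-- respectively (d̂, î), to the same pair of statistics on codes.
--
-- The bijections are two instances of one greedy encoding (module Selection).
-- A word is built letter by letter from a ranked list R of the values still
-- available; the code letter of a chosen value b is the number of later
-- letters y such that "b inverts y" in the current state.  When R is ranked
-- so that b inverts exactly the values in front of it, the code letter is
-- simply the position of b in R, so decoding and encoding are inverse, the
-- inversion statistic becomes the sum of the code and the descent statistic
-- becomes codeDes, a function of the code alone.
--
-- For σ ∈ S̃ₙ₊₁ the state is the previous letter a, "b inverts y" means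
-- σ-pattern a b y is odd, and R lists the remaining values in the cyclic
-- order starting just after a.  For ω ∈ Sₙ the state is the parity of the
-- position and R lists the remaining values increasingly or decreasingly.

open import Defs
open import Data.Nat using (ℕ; suc; _≤_)
open import Data.Product using (_,_; Σ; _×_; proj₁; proj₂)
open import Data.Sum using (_⊎_; inj₁; inj₂)
open import Data.List using (map)
open import Data.List.Relation.Binary.Permutation.Propositional using (_↭_)

open import Data.Bool using (Bool; true; false; not; T; T?; if_then_else_; _∧_)
open import Data.Bool.Properties using (T-∨; T-∧)
open import Data.Unit using (tt)
open import Data.Empty using (⊥; ⊥-elim)
open import Data.Nat using (zero; _+_; _<_; z≤n; s≤s; s≤s⁻¹; z<s; s<s; _<ᵇ_; _≤ᵇ_)
open import Data.Nat.Properties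
  using (+-comm; +-monoʳ-<; +-monoʳ-≤; <-trans; <-asym; <⇒≱; m≤n⇒m≤1+n; ≤-reflexive;
         <ᵇ⇒<; <⇒<ᵇ; ≤ᵇ⇒≤; ≤⇒≤ᵇ; ≡ᵇ⇒≡; suc-injective)
open import Data.Nat.ListAction using (sum)
open import Data.Nat.ListAction.Properties using (sum-↭)
open import Data.Fin using (Fin; toℕ; fromℕ<)
open import Data.Fin.Properties using (toℕ-injective; toℕ<n; toℕ-fromℕ<)
import Data.Fin.Properties as Fin
open import Data.Vec as Vec using (Vec; []; _∷_; toList)
open import Data.Vec.Properties using (toList-map; length-toList)
open import Data.List
  using (List; []; _∷_; _++_; length; take; drop; upTo; applyUpTo; allFin; reverse;
         cartesianProductWith; concatMap)
open import Data.List.Properties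
  using (length-++; length-upTo; length-applyUpTo; unfold-reverse; ∷-injectiveˡ; ∷-injectiveʳ;
         map-∘; map-cong-local; map-id)
open import Data.List.Membership.Propositional using (_∈_)
open import Data.List.Membership.Propositional.Properties
  using (∈-∃++; ∈-++⁺ʳ; ∈-map⁺; ∈-map⁻; ∈-upTo⁺; ∈-upTo⁻; ∈-allFin; ∈-filter⁺; ∈-filter⁻;
         ∈-cartesianProductWith⁺; ∈-cartesianProductWith⁻)
open import Data.List.Relation.Unary.Any using (here; there)
open import Data.List.Relation.Unary.All as All using (All; []; _∷_)
import Data.List.Relation.Unary.All.Properties as All
open import Data.List.Relation.Unary.AllPairs as AllPairs using (AllPairs; []; _∷_)
import Data.List.Relation.Unary.AllPairs.Properties as AllPairs
open import Data.List.Relation.Unary.Unique.Propositional using (Unique)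
import Data.List.Relation.Unary.Unique.Propositional.Properties as Unique
import Data.List.Relation.Unary.Unique.DecPropositional as DecUnique
open import Data.List.Relation.Binary.Permutation.Propositional
  using (↭-refl; ↭-sym; ↭-trans; ↭-prep; ↭⇒↭ₛ; module PermutationReasoning)
open import Data.List.Relation.Binary.Permutation.Propositional.Properties
  using (↭-length; ↭-reverse; map⁺; ++⁺; ++-comm; shift; drop-mid; drop-∷; ∈-resp-↭; All-resp-↭)
import Data.List.Relation.Binary.Permutation.Setoid.Properties as Permutationₛ
open import Data.List.Relation.Binary.BagAndSetEquality using (∼bag⇒↭)
open import Data.List.Membership.Propositional.Properties.WithK using (unique∧set⇒bag)
open import Function using (_∘_; flip)
open import Function.Bundles using (mk⇔; Equivalence)
open import Relation.Nullary using (¬_; Dec)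
open import Relation.Binary.PropositionalEquality
import Relation.Binary.PropositionalEquality.Properties as ≡

private variable A : Set

indicator : Bool → ℕ
indicator b = if b then 1 else 0

T-ext : ∀ {x y} → (T x → T y) → (T y → T x) → x ≡ y
T-ext {false} {false} _ _ = refl
T-ext {false} {true}  _ g = ⊥-elim (g tt)
T-ext {true}  {false} f _ = ⊥-elim (f tt)
T-ext {true}  {true}  _ _ = refl

count-as-sum : (p : A → Bool) (xs : List A) → count p xs ≡ sum (map (indicator ∘ p) xs)
count-as-sum p [] = refl
count-as-sum p (x ∷ xs) = cong (indicator (p x) +_) (count-as-sum p xs)

count-↭ : (p : A → Bool) {xs ys : List A} → xs ↭ ys → count p xs ≡ count p ys
count-↭ p {xs} {ys} xs↭ys = begin
  count p xs                      ≡⟨ count-as-sum p xs ⟩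
  sum (map (indicator ∘ p) xs)    ≡⟨ sum-↭ (map⁺ (indicator ∘ p) xs↭ys) ⟩
  sum (map (indicator ∘ p) ys)    ≡⟨ sym (count-as-sum p ys) ⟩
  count p ys                      ∎
  where open ≡-Reasoning

count-≤ : (p : A → Bool) (xs : List A) → count p xs ≤ length xs
count-≤ p [] = z≤n
count-≤ p (x ∷ xs) with p x
... | true  = s≤s (count-≤ p xs)
... | false = m≤n⇒m≤1+n (count-≤ p xs)

count-prefix : (p : A → Bool) {xs ys : List A} →
  All (T ∘ p) xs → All (¬_ ∘ T ∘ p) ys → count p (xs ++ ys) ≡ length xs
count-prefix p [] [] = refl
count-prefix p {ys = y ∷ _} [] (¬py ∷ ¬pys) with p y
... | true  = ⊥-elim (¬py tt)
... | false = count-prefix p [] ¬pys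
count-prefix p {x ∷ _} (px ∷ pxs) ¬pys with p x
... | true  = cong suc (count-prefix p pxs ¬pys)
... | false = ⊥-elim px

-- Code m cs: cs has length m and its i-th letter (from 0) is below m - i.
data Code : ℕ → List ℕ → Set where
  []  : Code 0 []
  _∷_ : ∀ {m c cs} → c < suc m → Code m cs → Code (suc m) (c ∷ cs)

Code-length : ∀ {m cs} → Code m cs → length cs ≡ m
Code-length [] = refl
Code-length (_ ∷ code) = cong suc (Code-length code)

codes : ℕ → List (List ℕ)
codes zero = [] ∷ []
codes (suc m) = cartesianProductWith _∷_ (upTo (suc m)) (codes m)

codes-unique : ∀ m → Unique (codes m)
codes-unique zero = [] ∷ []
codes-unique (suc m) =
  Unique.cartesianProductWith⁺ _∷_ ∷-injective (Unique.upTo⁺ (suc m)) (codes-unique m)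
  where
  ∷-injective : ∀ {w x : ℕ} {y z : List ℕ} → w ∷ y ≡ x ∷ z → w ≡ x × y ≡ z
  ∷-injective refl = refl , refl

∈codes⇒Code : ∀ {m cs} → cs ∈ codes m → Code m cs
∈codes⇒Code {zero} (here refl) = []
∈codes⇒Code {suc m} mem with ∈-cartesianProductWith⁻ _∷_ (upTo (suc m)) (codes m) mem
... | c , cs , c∈ , cs∈ , refl = ∈-upTo⁻ c∈ ∷ ∈codes⇒Code cs∈

Code⇒∈codes : ∀ {m cs} → Code m cs → cs ∈ codes m
Code⇒∈codes [] = here refl
Code⇒∈codes (c< ∷ code) = ∈-cartesianProductWith⁺ _∷_ (∈-upTo⁺ c<) (Code⇒∈codes code)

codeDes : List ℕ → ℕ
codeDes (c ∷ c' ∷ cs) = indicator (suc (length cs) ≤ᵇ c + c') + codeDes (c' ∷ cs)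
codeDes _ = 0

take-length : (pre post : List A) → take (length pre) (pre ++ post) ≡ pre
take-length [] post = refl
take-length (x ∷ pre) post = cong (x ∷_) (take-length pre post)

drop-length : (pre post : List A) → drop (length pre) (pre ++ post) ≡ post
drop-length [] post = refl
drop-length (x ∷ pre) post = drop-length pre post

record Choice (c : ℕ) (R : List A) : Set where
  constructor chosen
  field
    pre      : List A
    elem     : A
    post     : List A
    layout   : R ≡ pre ++ elem ∷ post
    position : length pre ≡ c

choose : ∀ {c m} (R : List A) → length R ≡ suc m → c < suc m → Choice c R
choose {c = zero} (b ∷ R) _ _ = chosen [] b R refl refl
choose {c = suc c} {m = suc m} (x ∷ R) len (s≤s c<) with choose R (suc-injective len) c<
... | chosen pre b post refl refl = chosen (x ∷ pre) b post refl refl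

located : (xs ys pre : List A) {b : A} {post : List A} → xs ++ ys ≡ pre ++ b ∷ post →
  (length pre < length xs × b ∈ xs) ⊎ (length xs ≤ length pre × b ∈ ys)
located [] ys pre refl = inj₂ (z≤n , ∈-++⁺ʳ pre (here refl))
located (x ∷ xs) ys [] refl = inj₁ (s≤s z≤n , here refl)
located (x ∷ xs) ys (_ ∷ pre) eq with located xs ys pre (∷-injectiveʳ eq)
... | inj₁ (lt , mem) = inj₁ (s≤s lt , there mem)
... | inj₂ (le , mem) = inj₂ (s≤s le , mem)

record AroundPairs (R : A → A → Set) (pre : List A) (b : A) (post : List A) : Set where
  field
    within-pre  : AllPairs R pre
    pre-b       : All (λ u → R u b) pre
    b-post      : All (R b) post
    within-post : AllPairs R post

around : ∀ {R : A → A → Set} pre b post → AllPairs R (pre ++ b ∷ post) → AroundPairs R pre b post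
around [] b post (b-post ∷ within-post) = record
  { within-pre = [] ; pre-b = [] ; b-post = b-post ; within-post = within-post }
around (x ∷ pre) b post (x-rest ∷ rest) with around pre b post rest | All.++⁻ pre x-rest
... | r | x-pre , (x-b ∷ _) = record
  { within-pre  = x-pre ∷ AroundPairs.within-pre r
  ; pre-b       = x-b ∷ AroundPairs.pre-b r
  ; b-post      = AroundPairs.b-post r
  ; within-post = AroundPairs.within-post r }

allPairs-with : ∀ {Q : A → Set} {R R' : A → A → Set} →
  (∀ {u v} → Q u → Q v → R u v → R' u v) → ∀ {xs} → All Q xs → AllPairs R xs → AllPairs R' xs
allPairs-with f [] [] = []
allPairs-with f (qx ∷ qs) (rx ∷ rs) =
  All.zipWith (λ (qy , r) → f qx qy r) (qs , rx) ∷ allPairs-with f qs rs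

all-cross : ∀ {xs ys : List A} {R : A → A → Set} →
  (∀ {u v} → u ∈ xs → v ∈ ys → R u v) → All (λ u → All (R u) ys) xs
all-cross f = All.tabulate (λ u∈ → All.tabulate (λ v∈ → f u∈ v∈))

reverse-allPairs : ∀ {R : A → A → Set} {xs} → AllPairs R xs → AllPairs (flip R) (reverse xs)
reverse-allPairs {xs = []} [] = []
reverse-allPairs {R = R} {x ∷ xs} (x-rest ∷ rest) =
  subst (AllPairs (flip R)) (sym (unfold-reverse x xs))
    (AllPairs.++⁺ (reverse-allPairs rest) ([] ∷ [])
      (All.map (_∷ []) (All-resp-↭ (↭-sym (↭-reverse xs)) x-rest)))

reverse-around : ∀ {R : A → A → Set} → (∀ {u v w} → R u v → R v w → R u w) →
  ∀ pre b post → AllPairs R (pre ++ b ∷ post) → AllPairs (flip R) (reverse post ++ reverse pre)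
reverse-around R-trans pre b post sorted =
  AllPairs.++⁺ (reverse-allPairs within-post) (reverse-allPairs within-pre) (all-cross λ u∈ v∈ →
    R-trans (All.lookup pre-b (∈-resp-↭ (↭-reverse pre) v∈))
            (All.lookup b-post (∈-resp-↭ (↭-reverse post) u∈)))
  where open AroundPairs (around pre b post sorted)

unique-same-members-↭ : {xs ys : List A} → Unique xs → Unique ys →
  (∀ {z} → z ∈ xs → z ∈ ys) → (∀ {z} → z ∈ ys → z ∈ xs) → xs ↭ ys
unique-same-members-↭ uxs uys to from = ∼bag⇒↭ (unique∧set⇒bag uxs uys (mk⇔ to from))

Ranked : {State : Set} → (State → ℕ → ℕ → Bool) → State → List ℕ → Set
Ranked inverts s = AllPairs (λ u v → T (inverts s v u))

-- Words are read letter by letter; reading b in state s moves to advance s b,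
-- and "inverts s b y" says that a later letter y contributes to the code
-- letter of b.
module Selection
  (State        : Set)
  (advance      : State → ℕ → State)
  (inverts      : State → ℕ → ℕ → Bool)
  (inverts-asym : ∀ {s b y} → T (inverts s y b) → ¬ T (inverts s b y))
  (regroup      : List ℕ → List ℕ)
  (regroup-↭    : ∀ xs → regroup xs ↭ xs)
  (rerank       : ∀ {s} pre b post → Ranked inverts s (pre ++ b ∷ post) →
                  Ranked inverts (advance s b) (regroup post ++ regroup pre))
  where

  remaining : List ℕ → List ℕ → List ℕ
  remaining pre post = regroup post ++ regroup pre

  remaining-↭ : ∀ pre post → remaining pre post ↭ pre ++ post
  remaining-↭ pre post = ↭-trans (++⁺ (regroup-↭ post) (regroup-↭ pre)) (++-comm post pre)

  remaining-length : ∀ pre post → length (remaining pre post) ≡ length pre + length (regroup post)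
  remaining-length pre post = begin
    length (regroup post ++ regroup pre)        ≡⟨ length-++ (regroup post) ⟩
    length (regroup post) + length (regroup pre) ≡⟨ +-comm (length (regroup post)) _ ⟩
    length (regroup pre) + length (regroup post)
      ≡⟨ cong (_+ length (regroup post)) (↭-length (regroup-↭ pre)) ⟩
    length pre + length (regroup post)           ∎
    where open ≡-Reasoning

  remaining-shorter : ∀ pre b post {m} → length (pre ++ b ∷ post) ≡ suc m →
    length (remaining pre post) ≡ m
  remaining-shorter pre b post len = suc-injective (begin
    suc (length (remaining pre post)) ≡⟨ cong suc (↭-length (remaining-↭ pre post)) ⟩
    suc (length (pre ++ post))        ≡⟨ sym (↭-length (shift b pre post)) ⟩
    length (pre ++ b ∷ post)          ≡⟨ len ⟩
    suc _                             ∎)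
    where open ≡-Reasoning

  mutual
    decode : State → List ℕ → List ℕ → List ℕ
    decode s R [] = []
    decode s R (c ∷ cs) = decodeAfter s cs (take c R) (drop c R)

    decodeAfter : State → List ℕ → List ℕ → List ℕ → List ℕ
    decodeAfter s cs pre [] = []
    decodeAfter s cs pre (b ∷ post) = b ∷ decode (advance s b) (remaining pre post) cs

  encode : State → List ℕ → List ℕ
  encode s [] = []
  encode s (b ∷ w) = count (inverts s b) w ∷ encode (advance s b) w

  inversions : State → List ℕ → ℕ
  inversions s [] = 0
  inversions s (b ∷ w) = count (inverts s b) w + inversions (advance s b) w

  descents : State → List ℕ → ℕ
  descents s (b ∷ b' ∷ w) = indicator (inverts s b b') + descents (advance s b) (b' ∷ w)
  descents s _ = 0

  inversions≡sum-encode : ∀ s w → inversions s w ≡ sum (encode s w)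
  inversions≡sum-encode s [] = refl
  inversions≡sum-encode s (b ∷ w) =
    cong (count (inverts s b) w +_) (inversions≡sum-encode (advance s b) w)

  encode-code : ∀ s w → Code (length w) (encode s w)
  encode-code s [] = []
  encode-code s (b ∷ w) = s≤s (count-≤ (inverts s b) w) ∷ encode-code (advance s b) w

  descents-cons : ∀ {s b b₂ D D₂} → D ≡ b₂ ∷ D₂ →
    descents s (b ∷ D) ≡ indicator (inverts s b b₂) + descents (advance s b) D
  descents-cons refl = refl

  decode-at : ∀ s pre b post cs →
    decode s (pre ++ b ∷ post) (length pre ∷ cs) ≡ b ∷ decode (advance s b) (remaining pre post) cs
  decode-at s pre b post cs rewrite take-length pre (b ∷ post) | drop-length pre (b ∷ post) = refl

  decode-choice : ∀ {s c R} cs (ch : Choice c R) → let open Choice ch in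
    decode s R (c ∷ cs) ≡ elem ∷ decode (advance s elem) (remaining pre post) cs
  decode-choice {s} cs (chosen pre b post refl refl) = decode-at s pre b post cs

  -- In a ranked list the chosen value inverts exactly the values before it,
  -- so its code letter is its position.
  inverts-before : ∀ {s} pre b post → Ranked inverts s (pre ++ b ∷ post) →
    All (T ∘ inverts s b) pre × All (¬_ ∘ T ∘ inverts s b) post
  inverts-before pre b post rk =
    AroundPairs.pre-b pairs , All.map inverts-asym (AroundPairs.b-post pairs)
    where pairs = around pre b post rk

  count-inverts : ∀ {s} pre b post {w} → Ranked inverts s (pre ++ b ∷ post) →
    w ↭ pre ++ post → count (inverts s b) w ≡ length pre
  count-inverts pre b post rk w↭ =
    trans (count-↭ _ w↭) (count-prefix _ (proj₁ before) (proj₂ before))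
    where before = inverts-before pre b post rk

  decode-↭ : ∀ {s R m cs} → Ranked inverts s R → length R ≡ m → Code m cs → decode s R cs ↭ R
  decode-↭ {R = []} _ _ [] = ↭-refl
  decode-↭ {s} {R} rk len (_∷_ {cs = cs} c< code) with choose R len c<
  ... | chosen pre b post refl refl = begin
    decode s (pre ++ b ∷ post) (length pre ∷ cs)        ≡⟨ decode-at s pre b post cs ⟩
    b ∷ decode (advance s b) (remaining pre post) cs     ↭⟨ ↭-prep b (decode-↭ rk′ len′ code) ⟩
    b ∷ remaining pre post                               ↭⟨ ↭-prep b (remaining-↭ pre post) ⟩
    b ∷ pre ++ post                                      ↭⟨ ↭-sym (shift b pre post) ⟩
    pre ++ b ∷ post                                      ∎
    where
    open PermutationReasoning
    rk′ = rerank pre b post rk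
    len′ = remaining-shorter pre b post len

  encode-decode : ∀ {s R m cs} → Ranked inverts s R → length R ≡ m → Code m cs →
    encode s (decode s R cs) ≡ cs
  encode-decode rk len [] = refl
  encode-decode {s} {R} rk len (_∷_ {cs = cs} c< code) with choose R len c<
  ... | chosen pre b post refl refl = begin
    encode s (decode s (pre ++ b ∷ post) (length pre ∷ cs))
      ≡⟨ cong (encode s) (decode-at s pre b post cs) ⟩
    count (inverts s b) rest ∷ encode (advance s b) rest
      ≡⟨ cong₂ _∷_ (count-inverts pre b post rk rest↭) (encode-decode rk′ len′ code) ⟩
    length pre ∷ cs
      ∎
    where
    open ≡-Reasoning
    rk′ = rerank pre b post rk
    len′ = remaining-shorter pre b post len
    rest = decode (advance s b) (remaining pre post) cs
    rest↭ : rest ↭ pre ++ post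
    rest↭ = ↭-trans (decode-↭ rk′ len′ code) (remaining-↭ pre post)

  decode-encode : ∀ {s R w} → Ranked inverts s R → w ↭ R → decode s R (encode s w) ≡ w
  decode-encode {w = []} _ _ = refl
  decode-encode {s} {R} {b ∷ w} rk b∷w↭ with ∈-∃++ (∈-resp-↭ b∷w↭ (here refl))
  ... | pre , post , refl = begin
    decode s (pre ++ b ∷ post) (count (inverts s b) w ∷ encode (advance s b) w)
      ≡⟨ cong (λ c → decode s (pre ++ b ∷ post) (c ∷ encode (advance s b) w))
              (count-inverts pre b post rk w↭) ⟩
    decode s (pre ++ b ∷ post) (length pre ∷ encode (advance s b) w)
      ≡⟨ decode-at s pre b post _ ⟩
    b ∷ decode (advance s b) (remaining pre post) (encode (advance s b) w)
      ≡⟨ cong (b ∷_) (decode-encode (rerank pre b post rk)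
                                    (↭-trans w↭ (↭-sym (remaining-↭ pre post)))) ⟩
    b ∷ w
      ∎
    where
    open ≡-Reasoning
    w↭ : w ↭ pre ++ post
    w↭ = drop-mid [] pre b∷w↭

  -- Whether the first two decoded letters b, b₂ form a descent is read off
  -- the first two code letters: b₂ comes from regroup pre exactly when the
  -- two positions add up to at least the number of values left after b.
  first-descent : ∀ {s pre b post pre₂ b₂ post₂ n} → Ranked inverts s (pre ++ b ∷ post) →
    remaining pre post ≡ pre₂ ++ b₂ ∷ post₂ → length (remaining pre post) ≡ n →
    inverts s b b₂ ≡ (n ≤ᵇ length pre + length pre₂)
  first-descent {pre = pre} {b} {post} {pre₂} {n = n} rk eq len
    with located (regroup post) (regroup pre) pre₂ eq
  ... | inj₁ (pre₂<post , b₂∈) =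
    T-ext (λ t → ⊥-elim (not-inverted t)) (λ t → ⊥-elim (<⇒≱ short (≤ᵇ⇒≤ n _ t)))
    where
    not-inverted = All.lookup (proj₂ (inverts-before pre b post rk)) (∈-resp-↭ (regroup-↭ post) b₂∈)
    short : length pre + length pre₂ < n
    short = subst (length pre + length pre₂ <_) (trans (sym (remaining-length pre post)) len)
                  (+-monoʳ-< (length pre) pre₂<post)
  ... | inj₂ (post≤pre₂ , b₂∈) = T-ext (λ _ → ≤⇒≤ᵇ long) (λ _ → inverted)
    where
    inverted = All.lookup (proj₁ (inverts-before pre b post rk)) (∈-resp-↭ (regroup-↭ pre) b₂∈)
    long : n ≤ length pre + length pre₂
    long = subst (_≤ length pre + length pre₂) (trans (sym (remaining-length pre post)) len)
                 (+-monoʳ-≤ (length pre) post≤pre₂)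

  descents-step : ∀ {s R m c c₂ cs} → Ranked inverts s R → length R ≡ suc (suc m) →
    c < suc (suc m) → c₂ < suc m → Code m cs →
    (∀ {s′ R′} → Ranked inverts s′ R′ → length R′ ≡ suc m →
       descents s′ (decode s′ R′ (c₂ ∷ cs)) ≡ codeDes (c₂ ∷ cs)) →
    descents s (decode s R (c ∷ c₂ ∷ cs)) ≡ codeDes (c ∷ c₂ ∷ cs)
  descents-step {s} {R} {cs = cs} rk len c< c₂< code shorter with choose R len c<
  ... | chosen pre b post refl refl
    with choose (remaining pre post) (remaining-shorter pre b post len) c₂<
  ... | choice₂@(chosen pre₂ b₂ post₂ eq refl) = begin
    descents s (decode s (pre ++ b ∷ post) (length pre ∷ length pre₂ ∷ cs))
      ≡⟨ cong (descents s) (decode-at s pre b post (length pre₂ ∷ cs)) ⟩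
    descents s (b ∷ rest)
      ≡⟨ descents-cons (decode-choice {advance s b} cs choice₂) ⟩
    indicator (inverts s b b₂) + descents (advance s b) rest
      ≡⟨ cong₂ _+_ (cong indicator (first-descent rk eq left)) (shorter rk′ len′) ⟩
    codeDes (length pre ∷ length pre₂ ∷ cs)
      ∎
    where
    open ≡-Reasoning
    rk′ = rerank pre b post rk
    len′ = remaining-shorter pre b post len
    rest = decode (advance s b) (remaining pre post) (length pre₂ ∷ cs)
    left : length (remaining pre post) ≡ suc (length cs)
    left = trans len′ (cong suc (sym (Code-length code)))

  descents-decode : ∀ {s R m cs} → Ranked inverts s R → length R ≡ m → Code m cs →
    descents s (decode s R cs) ≡ codeDes cs
  descents-decode rk len [] = refl
  descents-decode {s} {R} rk len (c< ∷ []) with choose R len c<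
  ... | chosen pre b post refl refl = cong (descents s) (decode-at s pre b post [])
  descents-decode rk len (c< ∷ (c₂< ∷ code)) =
    descents-step rk len c< c₂< code (λ rk′ len′ → descents-decode rk′ len′ (c₂< ∷ code))

  module _ {s₀ : State} {R₀ : List ℕ} {n : ℕ}
           (rk : Ranked inverts s₀ R₀) (len : length R₀ ≡ n) where

    decoded : List (List ℕ)
    decoded = map (decode s₀ R₀) (codes n)

    decoded-unique : Unique decoded
    decoded-unique = Unique.map⁻ (subst Unique (sym encode-decoded) (codes-unique n))
      where
      encode-decoded : map (encode s₀) decoded ≡ codes n
      encode-decoded = begin
        map (encode s₀) (map (decode s₀ R₀) (codes n)) ≡⟨ map-∘ (codes n) ⟨
        map (encode s₀ ∘ decode s₀ R₀) (codes n)
          ≡⟨ map-cong-local (All.tabulate (encode-decode rk len ∘ ∈codes⇒Code)) ⟩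
        map (λ cs → cs) (codes n)                      ≡⟨ map-id (codes n) ⟩
        codes n                                        ∎
        where open ≡-Reasoning

    arrangements↭decoded : {words : List (List ℕ)} → Unique words →
      (∀ {w} → w ∈ words → w ↭ R₀) → (∀ {w} → w ↭ R₀ → w ∈ words) → words ↭ decoded
    arrangements↭decoded uniq sound complete = unique-same-members-↭ uniq decoded-unique to from
      where
      to : ∀ {w} → w ∈ _ → w ∈ decoded
      to {w} w∈ = subst (_∈ decoded) (decode-encode rk (sound w∈))
        (∈-map⁺ (decode s₀ R₀) (Code⇒∈codes (subst (λ k → Code k (encode s₀ w))
          (trans (↭-length (sound w∈)) len) (encode-code s₀ w))))
      from : ∀ {w} → w ∈ decoded → w ∈ _
      from w∈ with ∈-map⁻ (decode s₀ R₀) w∈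
      ... | cs , cs∈ , refl = complete (decode-↭ rk len (∈codes⇒Code cs∈))

    statistics-via-codes : {words : List (List ℕ)} → Unique words →
      (∀ {w} → w ∈ words → w ↭ R₀) → (∀ {w} → w ↭ R₀ → w ∈ words) →
      map (λ w → descents s₀ w , inversions s₀ w) words
        ↭ map (λ cs → codeDes cs , sum cs) (codes n)
    statistics-via-codes {words} uniq sound complete = begin
      map statistics words
        ↭⟨ map⁺ statistics (arrangements↭decoded uniq sound complete) ⟩
      map statistics (map (decode s₀ R₀) (codes n))
        ≡⟨ map-∘ (codes n) ⟨
      map (statistics ∘ decode s₀ R₀) (codes n)
        ≡⟨ map-cong-local (All.tabulate (decoded-statistics ∘ ∈codes⇒Code)) ⟩
      map (λ cs → codeDes cs , sum cs) (codes n)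
        ∎
      where
      open PermutationReasoning
      statistics : List ℕ → ℕ × ℕ
      statistics w = descents s₀ w , inversions s₀ w
      decoded-statistics : ∀ {cs} → Code n cs →
        statistics (decode s₀ R₀ cs) ≡ (codeDes cs , sum cs)
      decoded-statistics {cs} code = cong₂ _,_ (descents-decode rk len code)
        (trans (inversions≡sum-encode s₀ (decode s₀ R₀ cs)) (cong sum (encode-decode rk len code)))

unique-↭ : {xs ys : List A} → xs ↭ ys → Unique xs → Unique ys
unique-↭ xs↭ys = Permutationₛ.Unique-resp-↭ (≡.setoid _) (↭⇒↭ₛ xs↭ys)

pigeonhole-↭ : {xs ys : List A} → Unique xs → Unique ys →
  (∀ {z} → z ∈ xs → z ∈ ys) → length ys ≤ length xs → xs ↭ ys
pigeonhole-↭ {xs = []} {[]} _ _ _ _ = ↭-refl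
pigeonhole-↭ {xs = []} {_ ∷ _} _ _ _ ()
pigeonhole-↭ {xs = x ∷ xs} (x∉xs ∷ uxs) uys sub le with ∈-∃++ (sub (here refl))
... | ys₁ , ys₂ , refl =
  ↭-trans (↭-prep x (pigeonhole-↭ uxs uys′ sub′ le′)) (↭-sym moved)
  where
  moved : ys₁ ++ x ∷ ys₂ ↭ x ∷ ys₁ ++ ys₂
  moved = shift x ys₁ ys₂
  uys′ : Unique (ys₁ ++ ys₂)
  uys′ = AllPairs.tail (unique-↭ moved uys)
  sub′ : ∀ {z} → z ∈ xs → z ∈ ys₁ ++ ys₂
  sub′ z∈ with ∈-resp-↭ moved (sub (there z∈))
  ... | here z≡x = ⊥-elim (All.lookup x∉xs z∈ (sym z≡x))
  ... | there z∈′ = z∈′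
  le′ : length (ys₁ ++ ys₂) ≤ length xs
  le′ = s≤s⁻¹ (subst (_≤ suc (length xs)) (↭-length moved) le)

words-cartesian : ∀ {m k} (xs : List (Fin m)) (ws : List (Vec (Fin m) k)) →
  concatMap (λ x → map (x ∷_) ws) xs ≡ cartesianProductWith _∷_ xs ws
words-cartesian [] ws = refl
words-cartesian (x ∷ xs) ws = cong (map (x ∷_) ws ++_) (words-cartesian xs ws)

words-unique : ∀ m k → Unique (words m k)
words-unique m zero = [] ∷ []
words-unique m (suc k) = subst Unique (sym (words-cartesian (allFin m) (words m k)))
  (Unique.cartesianProductWith⁺ _∷_ ∷-injective (Unique.allFin⁺ m) (words-unique m k))
  where
  ∷-injective : ∀ {w x : Fin m} {y z : Vec (Fin m) k} → w ∷ y ≡ x ∷ z → w ≡ x × y ≡ z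
  ∷-injective refl = refl , refl

words-complete : ∀ m k (v : Vec (Fin m) k) → v ∈ words m k
words-complete m zero [] = here refl
words-complete m (suc k) (x ∷ v) = subst (x ∷ v ∈_) (sym (words-cartesian (allFin m) (words m k)))
  (∈-cartesianProductWith⁺ _∷_ (∈-allFin x) (words-complete m k v))

values : ∀ {m k} → Vec (Fin m) k → List ℕ
values v = toList (Vec.map toℕ v)

distinct? : ∀ m (v : Vec (Fin m) m) → Dec (Unique (toList v))
distinct? m v = DecUnique.unique? (Fin._≟_ {m}) (toList v)

values-injective : ∀ {m k} {v w : Vec (Fin m) k} → values v ≡ values w → v ≡ w
values-injective {v = []} {[]} _ = refl
values-injective {v = x ∷ v} {y ∷ w} eq =
  cong₂ _∷_ (toℕ-injective (∷-injectiveˡ eq)) (values-injective (∷-injectiveʳ eq))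

as-values : ∀ {m k} (x : List ℕ) → All (_< m) x → length x ≡ k →
  Σ (Vec (Fin m) k) λ v → values v ≡ x
as-values [] [] refl = [] , refl
as-values (y ∷ x) (y< ∷ x<) refl with as-values x x< refl
... | v , v≡x = fromℕ< y< ∷ v , cong₂ _∷_ (toℕ-fromℕ< y<) v≡x

perms-unique : ∀ m → Unique (perms m)
perms-unique m = Unique.map⁺ values-injective (Unique.filter⁺ (distinct? m) (words-unique m m))

∈perms⇒↭ : ∀ {m x} → x ∈ perms m → x ↭ upTo m
∈perms⇒↭ {m} x∈ with ∈-map⁻ values x∈
... | v , v∈ , refl = pigeonhole-↭ unique-values (Unique.upTo⁺ m) below
        (≤-reflexive (trans (length-upTo m) (sym (length-toList (Vec.map toℕ v)))))
  where
  unique-values : Unique (values v)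
  unique-values = subst Unique (sym (toList-map toℕ v))
    (Unique.map⁺ toℕ-injective (proj₂ (∈-filter⁻ (distinct? m) {xs = words m m} v∈)))
  below : ∀ {z} → z ∈ values v → z ∈ upTo m
  below z∈ with ∈-map⁻ toℕ (subst (_ ∈_) (toList-map toℕ v) z∈)
  ... | i , _ , refl = ∈-upTo⁺ (toℕ<n i)

↭⇒∈perms : ∀ {m x} → x ↭ upTo m → x ∈ perms m
↭⇒∈perms {m} {x} x↭ with as-values {m} {m} x (All.tabulate (∈-upTo⁻ ∘ ∈-resp-↭ x↭))
                                           (trans (↭-length x↭) (length-upTo m))
... | v , refl = ∈-map⁺ values (∈-filter⁺ (distinct? m) (words-complete m m v) distinct)
  where
  distinct : Unique (toList v)
  distinct = Unique.map⁻ (subst Unique (toList-map toℕ v) (unique-↭ (↭-sym x↭) (Unique.upTo⁺ m)))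

-- Cyc x y z: x, y, z are met in this order when going around the circle
-- upwards (one of x < y < z, y < z < x, z < x < y).
data Cyc (x y z : ℕ) : Set where
  xyz : x < y → y < z → Cyc x y z
  yzx : y < z → z < x → Cyc x y z
  zxy : z < x → x < y → Cyc x y z

rotate : ∀ {x y z} → Cyc x y z → Cyc y z x
rotate (xyz p q) = zxy p q
rotate (yzx p q) = xyz p q
rotate (zxy p q) = yzx p q

Cyc-asym : ∀ {x y z} → Cyc x y z → Cyc z y x → ⊥
Cyc-asym (xyz p q) (xyz _ q′) = <-asym p q′
Cyc-asym (xyz p q) (yzx p′ _) = <-asym p p′
Cyc-asym (xyz p q) (zxy _ q′) = <-asym q q′
Cyc-asym (yzx p q) (xyz p′ _) = <-asym p p′
Cyc-asym (yzx p q) (yzx _ q′) = <-asym q q′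
Cyc-asym (yzx p q) (zxy _ q′) = <-asym p q′
Cyc-asym (zxy p q) (xyz _ q′) = <-asym q q′
Cyc-asym (zxy p q) (yzx p′ _) = <-asym q p′
Cyc-asym (zxy p q) (zxy p′ _) = <-asym p p′

Cyc-shift : ∀ {a b c d} → Cyc a b c → Cyc a c d → Cyc b c d
Cyc-shift (xyz p q) (xyz _ q′) = xyz q q′
Cyc-shift (xyz p q) (yzx _ q′) = zxy (<-trans q′ p) q
Cyc-shift (xyz p q) (zxy p′ _) = zxy (<-trans p′ p) q
Cyc-shift (yzx p q) (xyz p′ _) = ⊥-elim (<-asym q p′)
Cyc-shift (yzx p q) (yzx p′ _) = xyz p p′
Cyc-shift (yzx p q) (zxy _ q′) = ⊥-elim (<-asym q q′)
Cyc-shift (zxy p q) (xyz p′ _) = ⊥-elim (<-asym p p′)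
Cyc-shift (zxy p q) (yzx p′ q′) = yzx p′ (<-trans q′ q)
Cyc-shift (zxy p q) (zxy _ q′) = ⊥-elim (<-asym p q′)

both : ∀ {x y z w} → x < y → z < w → T ((x <ᵇ y) ∧ (z <ᵇ w))
both p q = Equivalence.from T-∧ (<⇒<ᵇ p , <⇒<ᵇ q)

odd3⇒Cyc : ∀ {a b c} → T (odd3 a b c) → Cyc a c b
odd3⇒Cyc {a} {b} {c} t with Equivalence.to T-∨ t
... | inj₁ t₁ = let p , q = Equivalence.to T-∧ t₁ in xyz (<ᵇ⇒< a c p) (<ᵇ⇒< c b q)
... | inj₂ t₂ with Equivalence.to T-∨ t₂
...   | inj₁ t₃ = let p , q = Equivalence.to T-∧ t₃ in zxy (<ᵇ⇒< b a p) (<ᵇ⇒< a c q)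
...   | inj₂ t₃ = let p , q = Equivalence.to T-∧ t₃ in yzx (<ᵇ⇒< c b p) (<ᵇ⇒< b a q)

Cyc⇒odd3 : ∀ {a b c} → Cyc a c b → T (odd3 a b c)
Cyc⇒odd3 {a} {b} {c} (xyz p q) = Equivalence.from T-∨ (inj₁ (both p q))
Cyc⇒odd3 {a} {b} {c} (zxy p q) =
  Equivalence.from (T-∨ {(a <ᵇ c) ∧ (c <ᵇ b)}) (inj₂ (Equivalence.from T-∨ (inj₁ (both p q))))
Cyc⇒odd3 {a} {b} {c} (yzx p q) =
  Equivalence.from (T-∨ {(a <ᵇ c) ∧ (c <ᵇ b)}) (inj₂ (Equivalence.from T-∨ (inj₂ (both p q))))

odd3-asym : ∀ {a b y} → T (odd3 a y b) → ¬ T (odd3 a b y)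
odd3-asym {a} {b} {y} h₁ h₂ = Cyc-asym (rotate (odd3⇒Cyc {a} {y} {b} h₁)) (odd3⇒Cyc {a} {b} {y} h₂)

odd3-rerank : ∀ {a} pre b post → Ranked odd3 a (pre ++ b ∷ post) → Ranked odd3 b (post ++ pre)
odd3-rerank {a} pre b post rk =
  AllPairs.map (λ {u} {v} → Cyc⇒odd3 {b} {v} {u})
    (AllPairs.++⁺ post-ranked pre-ranked post-before-pre)
  where
  open AroundPairs (around pre b post (AllPairs.map (λ {u} {v} → odd3⇒Cyc {a} {v} {u}) rk))
  post-ranked : AllPairs (Cyc b) post
  post-ranked = allPairs-with (λ bu _ uv → Cyc-shift bu uv) b-post within-post
  pre-ranked : AllPairs (Cyc b) pre
  pre-ranked = allPairs-with (λ _ vb uv → rotate (rotate (Cyc-shift uv vb))) pre-b within-pre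
  post-before-pre : All (λ u → All (Cyc b u) pre) post
  post-before-pre = all-cross (λ u∈ v∈ →
    rotate (Cyc-shift (All.lookup pre-b v∈) (All.lookup b-post u∈)))

module Cyclic = Selection ℕ (λ _ b → b) odd3 (λ {a} {b} {y} → odd3-asym {a} {b} {y})
  (λ xs → xs) (λ _ → ↭-refl) odd3-rerank

d3≡descents : ∀ a w → d3 (a ∷ w) ≡ Cyclic.descents a w
d3≡descents a [] = refl
d3≡descents a (b ∷ []) = refl
d3≡descents a (b ∷ c ∷ w) = cong (indicator (odd3 a b c) +_) (d3≡descents b (c ∷ w))

i3≡inversions : ∀ a w → i3 (a ∷ w) ≡ Cyclic.inversions a w
i3≡inversions a [] = refl
i3≡inversions a (b ∷ w) = cong (count (odd3 a b) w +_) (i3≡inversions b w)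

-- Values are 0-based, so S̃ₙ₊₁ consists of the permutations of 0 … n
-- starting with 0; removing that letter identifies them with the
-- arrangements of 1 … n.
starts-min? : (σ : List ℕ) → Dec (T (startsMin σ))
starts-min? σ = T? (startsMin σ)

tail : List ℕ → List ℕ
tail [] = []
tail (_ ∷ w) = w

∈permsFix1 : ∀ {m σ} → σ ∈ permsFix1 m → σ ∈ perms m × σ ≡ 0 ∷ tail σ
∈permsFix1 {m} σ∈ with ∈-filter⁻ starts-min? {xs = perms m} σ∈
... | σ∈perms , starts = σ∈perms , starts-with-0 _ starts
  where
  starts-with-0 : ∀ σ → T (startsMin σ) → σ ≡ 0 ∷ tail σ
  starts-with-0 (x ∷ w) t = cong (_∷ w) (≡ᵇ⇒≡ x 0 t)

tails : ℕ → List (List ℕ)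
tails n = map tail (permsFix1 (suc n))

tails-unique : ∀ n → Unique (tails n)
tails-unique n =
  Unique.map⁻ (subst Unique restore (Unique.filter⁺ starts-min? (perms-unique (suc n))))
  where
  restore : permsFix1 (suc n) ≡ map (0 ∷_) (tails n)
  restore = begin
    permsFix1 (suc n)                       ≡⟨ map-id (permsFix1 (suc n)) ⟨
    map (λ σ → σ) (permsFix1 (suc n))
      ≡⟨ map-cong-local (All.tabulate (proj₂ ∘ ∈permsFix1 {suc n})) ⟩
    map ((0 ∷_) ∘ tail) (permsFix1 (suc n)) ≡⟨ map-∘ (permsFix1 (suc n)) ⟩
    map (0 ∷_) (tails n)                    ∎
    where open ≡-Reasoning

∈tails⇒↭ : ∀ n {w} → w ∈ tails n → w ↭ applyUpTo suc n
∈tails⇒↭ n w∈ with ∈-map⁻ tail w∈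
... | σ , σ∈ , refl with ∈permsFix1 σ∈
... | σ∈perms , σ≡ = drop-∷ (subst (_↭ upTo (suc n)) σ≡ (∈perms⇒↭ σ∈perms))

↭⇒∈tails : ∀ n {w} → w ↭ applyUpTo suc n → w ∈ tails n
↭⇒∈tails n w↭ = ∈-map⁺ tail (∈-filter⁺ starts-min? (↭⇒∈perms (↭-prep 0 w↭)) tt)

increasing-ranked-after-min : ∀ n → Ranked odd3 0 (applyUpTo suc n)
increasing-ranked-after-min n =
  AllPairs.applyUpTo⁺₁ suc n (λ i<j _ → Cyc⇒odd3 {0} (xyz z<s (s<s i<j)))

permsFix1-via-codes : ∀ n →
  map (λ σ → d3 σ , i3 σ) (permsFix1 (suc n)) ↭ map (λ cs → codeDes cs , sum cs) (codes n)
permsFix1-via-codes n =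
  subst (_↭ map (λ cs → codeDes cs , sum cs) (codes n)) (sym statistics-of-tails)
  (Cyclic.statistics-via-codes (increasing-ranked-after-min n) (length-applyUpTo suc n)
    (tails-unique n) (∈tails⇒↭ n) (↭⇒∈tails n))
  where
  statistics-of-tails : map (λ σ → d3 σ , i3 σ) (permsFix1 (suc n))
                      ≡ map (λ w → Cyclic.descents 0 w , Cyclic.inversions 0 w) (tails n)
  statistics-of-tails =
    trans (map-cong-local (All.tabulate split-off-0)) (map-∘ (permsFix1 (suc n)))
    where
    split-off-0 : ∀ {σ} → σ ∈ permsFix1 (suc n) →
      (d3 σ , i3 σ) ≡ (Cyclic.descents 0 (tail σ) , Cyclic.inversions 0 (tail σ))
    split-off-0 {σ} σ∈ rewrite proj₂ (∈permsFix1 {suc n} σ∈) =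
      cong₂ _,_ (d3≡descents 0 (tail σ)) (i3≡inversions 0 (tail σ))

alternating : Bool → ℕ → ℕ → Bool
alternating odd b y = if odd then y <ᵇ b else b <ᵇ y

alternating-asym : ∀ {odd b y} → T (alternating odd y b) → ¬ T (alternating odd b y)
alternating-asym {true}  {b} {y} h₁ h₂ = <-asym (<ᵇ⇒< b y h₁) (<ᵇ⇒< y b h₂)
alternating-asym {false} {b} {y} h₁ h₂ = <-asym (<ᵇ⇒< y b h₁) (<ᵇ⇒< b y h₂)

<ᵇ-trans : ∀ {u v w} → T (u <ᵇ v) → T (v <ᵇ w) → T (u <ᵇ w)
<ᵇ-trans {u} {v} {w} p q = <⇒<ᵇ (<-trans (<ᵇ⇒< u v p) (<ᵇ⇒< v w q))

alternating-rerank : ∀ {odd} pre b post → Ranked alternating odd (pre ++ b ∷ post) →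
  Ranked alternating (not odd) (reverse post ++ reverse pre)
alternating-rerank {true}  = reverse-around λ {u} {v} {w} → <ᵇ-trans {u} {v} {w}
alternating-rerank {false} = reverse-around λ {u} {v} {w} p q → <ᵇ-trans {w} {v} {u} q p

module Alternating = Selection Bool (λ odd _ → not odd) alternating
  (λ {odd} {b} {y} → alternating-asym {odd} {b} {y}) reverse ↭-reverse alternating-rerank

dhatAux≡descents : ∀ odd w → dhatAux odd w ≡ Alternating.descents odd w
dhatAux≡descents odd [] = refl
dhatAux≡descents odd (b ∷ []) = refl
dhatAux≡descents odd (b ∷ c ∷ w) =
  cong (indicator (alternating odd b c) +_) (dhatAux≡descents (not odd) (c ∷ w))

ihatAux≡inversions : ∀ odd w → ihatAux odd w ≡ Alternating.inversions odd w
ihatAux≡inversions odd [] = refl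
ihatAux≡inversions odd (b ∷ w) =
  cong (count (alternating odd b) w +_) (ihatAux≡inversions (not odd) w)

increasing-ranked-at-odd : ∀ n → Ranked alternating true (upTo n)
increasing-ranked-at-odd n = AllPairs.applyUpTo⁺₁ (λ i → i) n (λ i<j _ → <⇒<ᵇ i<j)

perms-via-codes : ∀ n →
  map (λ ω → dhat ω , ihat ω) (perms n) ↭ map (λ cs → codeDes cs , sum cs) (codes n)
perms-via-codes n =
  subst (_↭ map (λ cs → codeDes cs , sum cs) (codes n)) (sym statistics-agree)
  (Alternating.statistics-via-codes (increasing-ranked-at-odd n) (length-upTo n)
    (perms-unique n) ∈perms⇒↭ ↭⇒∈perms)
  where
  statistics-agree :
    map (λ ω → dhat ω , ihat ω) (perms n)
      ≡ map (λ w → Alternating.descents true w , Alternating.inversions true w) (perms n)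
  statistics-agree = map-cong-local (All.tabulate λ {ω} _ →
    cong₂ _,_ (dhatAux≡descents true ω) (ihatAux≡inversions true ω))

-- Theorem 3.7.

theorem3p7 : (n : ℕ) → 1 ≤ n →
    map (λ σ → d3 σ , i3 σ) (permsFix1 (suc n)) ↭ map (λ ω → dhat ω , ihat ω) (perms n)
theorem3p7 n _ = ↭-trans (permsFix1-via-codes n) (↭-sym (perms-via-codes n))
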